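{- Let $H=(V,F)$ be an $s$-connector and let $G=(V,E)$ be a spanning subgraph of $H$. Let $G'$ be the output of the CD-saturation procedure applied to $G$ with host $H$, and write $\mathsf{GE}(G')=(C',A',D')$. Then $G\subseteq G'\subseteq H$, either $|C'|<s$ or $|C'|>|V|-2s$, and $\nu(G')=\nu(G)$.
   Context: $\nu(\cdot)$ denotes matching number. A graph $H=(V,F)$ is an $s$-connector if $F$ contains an edge between $X$ and $Y$ for every pair of disjoint $X,Y\subseteq V$ with $|X|,|Y|\ge s$. A vertex is essential in a graph if it is covered by every maximum matching, and inessential otherwise. The Gallai–Edmonds decomposition $\mathsf{GE}(G)=(C,A,D)$: $D$ is the set of inessential vertices, $A$ the set of vertices of $V\setminus D$ adjacent to some vertex of $D$, and $C=V\setminus(D\cup A)$. The CD-saturation procedure (with input $G=(V,E)$ and host $H=(V,F)$, $E\subseteq F$): repeatedly compute $(C,A,D)=\mathsf{GE}(G)$ for the current $G$; while $F$ contains an edge with one endpoint in $C$ and the other in $D$, choose any such edge and add it to $E$; when no such edge exists, output the current graph $G$. (The claim holds for every possible sequence of choices.) -}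

module Defs where

open import Data.Nat using (ℕ; _<_; _≤_; _+_; _*_)
open import Data.Fin using (Fin; _≟_)
open import Data.Fin.Subset using (Subset; _∈_; _∩_; Empty; ∣_∣)
open import Data.Bool using (Bool; true; false; _∨_; _∧_)
open import Data.List using (List; []; _∷_; length; concatMap)
open import Data.List.Relation.Unary.All using (All)
open import Data.List.Relation.Unary.Unique.Propositional using (Unique)
import Data.List.Membership.Propositional as LM
open import Data.Product using (Σ; ∃; _×_; _,_)
open import Data.Sum using (_⊎_)
open import Relation.Nullary using (¬_; ⌊_⌋)
open import Relation.Binary.PropositionalEquality using (_≡_)

Graph : ℕ → Set
Graph n = Fin n → Fin n → Bool

IsGraph : ∀ {n} → Graph n → Set
IsGraph {n} G = (∀ u v → G u v ≡ true → G v u ≡ true) × (∀ u → G u u ≡ false)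

_⊆ᴳ_ : ∀ {n} → Graph n → Graph n → Set
G ⊆ᴳ H = ∀ u v → G u v ≡ true → H u v ≡ true

addEdge : ∀ {n} → Graph n → Fin n → Fin n → Graph n
addEdge G u v x y = G x y ∨ (⌊ x ≟ u ⌋ ∧ ⌊ y ≟ v ⌋) ∨ (⌊ x ≟ v ⌋ ∧ ⌊ y ≟ u ⌋)

IsConnector : ∀ {n} → ℕ → Graph n → Set
IsConnector {n} s H =
  (X Y : Subset n) → Empty (X ∩ Y) → s ≤ ∣ X ∣ → s ≤ ∣ Y ∣ →
  Σ (Fin n) λ x → Σ (Fin n) λ y → x ∈ X × y ∈ Y × H x y ≡ true

endpoints : ∀ {n} → List (Fin n × Fin n) → List (Fin n)
endpoints = concatMap (λ { (u , v) → u ∷ v ∷ [] })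

IsMatching : ∀ {n} → Graph n → List (Fin n × Fin n) → Set
IsMatching G M = All (λ { (u , v) → G u v ≡ true }) M × Unique (endpoints M)

IsMaximumMatching : ∀ {n} → Graph n → List (Fin n × Fin n) → Set
IsMaximumMatching G M =
  IsMatching G M × (∀ M' → IsMatching G M' → length M' ≤ length M)

MatchingNumber : ∀ {n} → Graph n → ℕ → Set
MatchingNumber G k =
  (Σ _ λ M → IsMatching G M × length M ≡ k) × (∀ M → IsMatching G M → length M ≤ k)

Covers : ∀ {n} → List (Fin n × Fin n) → Fin n → Set
Covers M v = v LM.∈ endpoints M

Essential : ∀ {n} → Graph n → Fin n → Set
Essential G v = ∀ M → IsMaximumMatching G M → Covers M v

InD : ∀ {n} → Graph n → Fin n → Set
InD G v = ¬ Essential G v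

InA : ∀ {n} → Graph n → Fin n → Set
InA G v = ¬ InD G v × ∃ λ w → InD G w × G v w ≡ true

InC : ∀ {n} → Graph n → Fin n → Set
InC G v = ¬ InD G v × ¬ InA G v

-- CDSat H G G' : G' is a possible output of the CD-saturation procedure
-- with input G and host H (for some sequence of choices).
data CDSat {n} (H : Graph n) : Graph n → Graph n → Set where
  stop : ∀ {G} →
    ¬ (Σ (Fin n) λ u → Σ (Fin n) λ v → H u v ≡ true × InC G u × InD G v) →
    CDSat H G G
  step : ∀ {G G'} (u v : Fin n) →
    H u v ≡ true → InC G u → InD G v →
    CDSat H (addEdge G u v) G' → CDSat H G G'

{-# OPTIONS --safe #-}

-- Adding an edge uv with u ∈ C cannot raise ν: a larger matching of G + uv
-- covers u, and deleting its edge at u leaves a maximum matching of G that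
-- exposes u, i.e. u ∈ D. So every CD-saturation step preserves ν, and at the
-- end H has no edge between C' and D'; if |C'| ≥ s, the connector property
-- therefore forces |D'| < s. In a maximum matching M every vertex a ∈ A' is
-- matched into D': if ab ∈ M and ad ∈ E with d ∈ D', an alternating walk
-- starting with d, a turns M and a maximum matching exposing d into a maximum
-- matching exposing b or one exposing a, and the latter contradicts a ∉ D'.
-- Hence |A'| ≤ |D'| and n = |C'| + |A'| + |D'| < |C'| + 2s.

module Submission where

open import Data.Bool using (true; false; _∨_)
import Data.Bool as Bool
open import Data.Bool.Properties using (∨-zeroʳ)
open import Data.Empty using (⊥; ⊥-elim)
open import Data.Fin using (Fin; zero; suc; _≟_)
import Data.Fin.Properties as Fin
open import Data.Fin.Subset using (Subset; _∈_; ∣_∣; _∪_; _∩_; ⊤; inside; outside; Empty)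
open import Data.Fin.Subset.Properties using (x∈p∪q⁺; x∈p∩q⁻; p⊆q⇒∣p∣≤∣q∣; ∣⊤∣≡n; ∣p∣≤∣x∷p∣)
open import Data.List using (List; []; _∷_; length; map)
open import Data.List.Membership.Propositional using () renaming (_∈_ to _∈ₗ_; _∉_ to _∉ₗ_)
open import Data.List.Membership.Propositional.Properties using (∈-allFin; ∈-map⁺; ∈-map⁻)
open import Data.List.Properties using (length-removeAt′; length-map; length-tabulate)
open import Data.List.Relation.Binary.Subset.Propositional using (_⊆_)
open import Data.List.Relation.Unary.All using ([]; _∷_)
import Data.List.Relation.Unary.All as All
open import Data.List.Relation.Unary.All.Properties using (─⁺; ¬Any⇒All¬)
open import Data.List.Relation.Unary.AllPairs using ([]; _∷_; allPairs?)
open import Data.List.Relation.Unary.Any using (here; there; _─_; index)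
import Data.List.Relation.Unary.Any as Any
open import Data.List.Relation.Unary.Unique.Propositional using (Unique)
import Data.List.Relation.Unary.Unique.Propositional.Properties as Unique
open import Data.Nat using (ℕ; zero; suc; _+_; _*_; _≤_; _<_; _≤?_; z≤n; s≤s)
open import Data.Nat.Properties
  using ( ≤-trans; ≤-reflexive; ≤-antisym; ≤-pred; ≤∧≢⇒<; 1+n≰n; <⇒≱; ≰⇒>; <-≤-trans; ≤-<-trans
        ; n≤1+n; m<m+n; m≤n⇒m≤1+n; +-monoʳ-≤; +-monoʳ-<; +-mono-<; +-suc; +-identityʳ; module ≤-Reasoning )
open import Data.Product using (Σ; ∃; ∃-syntax; _×_; _,_; proj₁; proj₂; map₂)
open import Data.Sum using (_⊎_; inj₁; inj₂; [_,_]′)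
open import Data.Vec using ([]; _∷_; here; there; tabulate)
open import Data.Vec.Properties using (lookup⇒[]=; []=⇒lookup; lookup∘tabulate)
open import Function using (_∘_)
open import Relation.Binary.PropositionalEquality
  using (_≡_; _≢_; refl; sym; trans; cong; subst; subst₂; module ≡-Reasoning)
open import Relation.Nullary using (¬_; Dec; yes; no; does; ¬?)
open import Relation.Nullary.Decidable using (dec-true; map′; _×-dec_)
open import Relation.Unary using (Decidable)

open import Defs

-- Counting duplicate-free lists and subsets

∈-─⁻ : ∀ {A : Set} {x y : A} {xs : List A} (i : x ∈ₗ xs) → y ∈ₗ (xs ─ i) → y ∈ₗ xs
∈-─⁻ (here _)  j         = there j
∈-─⁻ (there i) (here p)  = here p
∈-─⁻ (there i) (there j) = there (∈-─⁻ i j)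

∈-─⁺ : ∀ {A : Set} {x y : A} {xs : List A} (i : x ∈ₗ xs) → y ∈ₗ xs → y ≢ x → y ∈ₗ (xs ─ i)
∈-─⁺ (here refl) (here refl) y≢x = ⊥-elim (y≢x refl)
∈-─⁺ (here _)    (there j)   _   = j
∈-─⁺ (there i)   (here p)    _   = here p
∈-─⁺ (there i)   (there j)   y≢x = there (∈-─⁺ i j y≢x)

injectiveOn⇒length≤ : ∀ {A B : Set} {xs : List A} {ys : List B} (f : A → B) → Unique xs →
  (∀ {x} → x ∈ₗ xs → f x ∈ₗ ys) → (∀ {x y} → x ∈ₗ xs → y ∈ₗ xs → f x ≡ f y → x ≡ y) →
  length xs ≤ length ys
injectiveOn⇒length≤ {xs = []}     f _               _    _   = z≤n
injectiveOn⇒length≤ {xs = x ∷ xs} {ys} f (x∉xs ∷ xs!) into inj = begin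
  suc (length xs)       ≤⟨ s≤s (injectiveOn⇒length≤ f xs! into′ (λ i j → inj (there i) (there j))) ⟩
  suc (length (ys ─ k)) ≡⟨ sym (length-removeAt′ ys (index k)) ⟩
  length ys             ∎
  where
  open ≤-Reasoning
  k = into (here refl)
  into′ : ∀ {y} → y ∈ₗ xs → f y ∈ₗ (ys ─ k)
  into′ j = ∈-─⁺ k (into (there j)) (λ fy≡fx → All.lookup x∉xs j (sym (inj (there j) (here refl) fy≡fx)))

Unique⇒length≤ : ∀ {A : Set} {xs ys : List A} → Unique xs → xs ⊆ ys → length xs ≤ length ys
Unique⇒length≤ xs! xs⊆ys = injectiveOn⇒length≤ (λ x → x) xs! xs⊆ys (λ _ _ eq → eq)

Unique⇒length≤n : ∀ {n} {xs : List (Fin n)} → Unique xs → length xs ≤ n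
Unique⇒length≤n {n} {xs} xs! =
  subst (length xs ≤_) (length-tabulate (λ i → i)) (Unique⇒length≤ xs! (λ {x} _ → ∈-allFin x))

elements : ∀ {n} → Subset n → List (Fin n)
elements []            = []
elements (inside ∷ p)  = zero ∷ map suc (elements p)
elements (outside ∷ p) = map suc (elements p)

elements-unique : ∀ {n} (p : Subset n) → Unique (elements p)
elements-unique []            = []
elements-unique (inside ∷ p)  = All.tabulate zero∉ ∷ Unique.map⁺ Fin.suc-injective (elements-unique p)
  where
  zero∉ : ∀ {y} → y ∈ₗ map suc (elements p) → zero ≢ y
  zero∉ j with ∈-map⁻ suc j
  ... | _ , _ , refl = λ ()
elements-unique (outside ∷ p) = Unique.map⁺ Fin.suc-injective (elements-unique p)

∈-elements⁻ : ∀ {n} (p : Subset n) {x} → x ∈ₗ elements p → x ∈ p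
∈-elements⁻ (inside ∷ p)  (here refl) = here
∈-elements⁻ (inside ∷ p)  (there j) with ∈-map⁻ suc j
... | _ , j′ , refl = there (∈-elements⁻ p j′)
∈-elements⁻ (outside ∷ p) j with ∈-map⁻ suc j
... | _ , j′ , refl = there (∈-elements⁻ p j′)

∈-elements⁺ : ∀ {n} {p : Subset n} {x} → x ∈ p → x ∈ₗ elements p
∈-elements⁺ {p = inside ∷ p}  here      = here refl
∈-elements⁺ {p = inside ∷ p}  (there m) = there (∈-map⁺ suc (∈-elements⁺ m))
∈-elements⁺ {p = outside ∷ p} (there m) = ∈-map⁺ suc (∈-elements⁺ m)

length-elements : ∀ {n} (p : Subset n) → length (elements p) ≡ ∣ p ∣
length-elements []            = refl
length-elements (inside ∷ p)  = cong suc (trans (length-map suc (elements p)) (length-elements p))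
length-elements (outside ∷ p) = trans (length-map suc (elements p)) (length-elements p)

injectiveOn⇒∣p∣≤∣q∣ : ∀ {n} (p q : Subset n) (f : Fin n → Fin n) → (∀ {x} → x ∈ p → f x ∈ q) →
  (∀ {x y} → x ∈ p → y ∈ p → f x ≡ f y → x ≡ y) → ∣ p ∣ ≤ ∣ q ∣
injectiveOn⇒∣p∣≤∣q∣ p q f into inj =
  subst₂ _≤_ (length-elements p) (length-elements q)
    (injectiveOn⇒length≤ f (elements-unique p) (λ i → ∈-elements⁺ (into (∈-elements⁻ p i)))
      (λ i j → inj (∈-elements⁻ p i) (∈-elements⁻ p j)))

∣p∪q∣≤∣p∣+∣q∣ : ∀ {n} (p q : Subset n) → ∣ p ∪ q ∣ ≤ ∣ p ∣ + ∣ q ∣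
∣p∪q∣≤∣p∣+∣q∣ []            []            = z≤n
∣p∪q∣≤∣p∣+∣q∣ (inside ∷ p)  (t ∷ q)       =
  s≤s (≤-trans (∣p∪q∣≤∣p∣+∣q∣ p q) (+-monoʳ-≤ ∣ p ∣ (∣p∣≤∣x∷p∣ t q)))
∣p∪q∣≤∣p∣+∣q∣ (outside ∷ p) (inside ∷ q)  =
  ≤-trans (s≤s (∣p∪q∣≤∣p∣+∣q∣ p q)) (≤-reflexive (sym (+-suc ∣ p ∣ ∣ q ∣)))
∣p∪q∣≤∣p∣+∣q∣ (outside ∷ p) (outside ∷ q) = ∣p∪q∣≤∣p∣+∣q∣ p q

cover⇒n≤∣p∣+∣q∣+∣r∣ : ∀ {n} (p q r : Subset n) → (∀ x → x ∈ p ⊎ x ∈ q ⊎ x ∈ r) →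
  n ≤ ∣ p ∣ + (∣ q ∣ + ∣ r ∣)
cover⇒n≤∣p∣+∣q∣+∣r∣ {n} p q r cover = begin
  n                       ≡⟨ sym (∣⊤∣≡n n) ⟩
  ∣ ⊤ {n} ∣               ≤⟨ p⊆q⇒∣p∣≤∣q∣ {p = ⊤} (λ {x} _ → ∈p∪q∪r x) ⟩
  ∣ p ∪ (q ∪ r) ∣         ≤⟨ ∣p∪q∣≤∣p∣+∣q∣ p (q ∪ r) ⟩
  ∣ p ∣ + ∣ q ∪ r ∣       ≤⟨ +-monoʳ-≤ ∣ p ∣ (∣p∪q∣≤∣p∣+∣q∣ q r) ⟩
  ∣ p ∣ + (∣ q ∣ + ∣ r ∣) ∎
  where
  open ≤-Reasoning
  ∈p∪q∪r : ∀ x → x ∈ p ∪ (q ∪ r)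
  ∈p∪q∪r x with cover x
  ... | inj₁ x∈p        = x∈p∪q⁺ (inj₁ x∈p)
  ... | inj₂ (inj₁ x∈q) = x∈p∪q⁺ (inj₂ (x∈p∪q⁺ (inj₁ x∈q)))
  ... | inj₂ (inj₂ x∈r) = x∈p∪q⁺ (inj₂ (x∈p∪q⁺ (inj₂ x∈r)))

module _ {n : ℕ} {P : Fin n → Set} (P? : Decidable P) where

  subsetOf : Subset n
  subsetOf = tabulate (λ x → does (P? x))

  ∈-subsetOf⁺ : ∀ {x} → P x → x ∈ subsetOf
  ∈-subsetOf⁺ {x} px = lookup⇒[]= x subsetOf (trans (lookup∘tabulate _ x) (dec-true (P? x) px))

  ∈-subsetOf⁻ : ∀ {x} → x ∈ subsetOf → P x
  ∈-subsetOf⁻ {x} x∈ with P? x | trans (sym (lookup∘tabulate (λ x → does (P? x)) x)) ([]=⇒lookup x∈)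
  ... | yes px | _ = px
  ... | no _   | ()

-- Matchings as edge lists

EdgeList : ℕ → Set
EdgeList n = List (Fin n × Fin n)

private
  variable
    n : ℕ
    G : Graph n
    M : EdgeList n
    e : Fin n × Fin n
    u v t p q : Fin n

Matched : EdgeList n → Fin n → Fin n → Set
Matched M u v = (u , v) ∈ₗ M ⊎ (v , u) ∈ₗ M

Disjoint : EdgeList n → Set
Disjoint M = Unique (endpoints M)

matched-sym : Matched M u v → Matched M v u
matched-sym (inj₁ i) = inj₂ i
matched-sym (inj₂ i) = inj₁ i

matched-there : Matched M u v → Matched (e ∷ M) u v
matched-there (inj₁ i) = inj₁ (there i)
matched-there (inj₂ i) = inj₂ (there i)

matched-∷⁻ : Matched ((p , q) ∷ M) u v → (u ≡ p × v ≡ q) ⊎ (u ≡ q × v ≡ p) ⊎ Matched M u v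
matched-∷⁻ (inj₁ (here refl)) = inj₁ (refl , refl)
matched-∷⁻ (inj₂ (here refl)) = inj₂ (inj₁ (refl , refl))
matched-∷⁻ (inj₁ (there i))   = inj₂ (inj₂ (inj₁ i))
matched-∷⁻ (inj₂ (there i))   = inj₂ (inj₂ (inj₂ i))

covers-∷⁻ : ∀ M → Covers ((p , q) ∷ M) t → t ≡ p ⊎ t ≡ q ⊎ Covers M t
covers-∷⁻ M (here refl)         = inj₁ refl
covers-∷⁻ M (there (here refl)) = inj₂ (inj₁ refl)
covers-∷⁻ M (there (there c))   = inj₂ (inj₂ c)

∈⇒covers-fst : (u , v) ∈ₗ M → Covers M u
∈⇒covers-fst {M = _ ∷ M} (here refl) = here refl
∈⇒covers-fst {M = _ ∷ M} (there i)   = there (there (∈⇒covers-fst i))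

∈⇒covers-snd : (u , v) ∈ₗ M → Covers M v
∈⇒covers-snd {M = _ ∷ M} (here refl) = there (here refl)
∈⇒covers-snd {M = _ ∷ M} (there i)   = there (there (∈⇒covers-snd i))

matched⇒covers : Matched M u v → Covers M u
matched⇒covers (inj₁ i) = ∈⇒covers-fst i
matched⇒covers (inj₂ i) = ∈⇒covers-snd i

covers⇒matched : ∀ M → Covers M u → ∃ (Matched M u)
covers⇒matched ((p , q) ∷ M) (here refl)         = q , inj₁ (here refl)
covers⇒matched ((p , q) ∷ M) (there (here refl)) = p , inj₂ (here refl)
covers⇒matched ((p , q) ∷ M) (there (there c))   = map₂ matched-there (covers⇒matched M c)

disjoint-tail : ∀ M → Disjoint ((p , q) ∷ M) → Disjoint M
disjoint-tail M (_ ∷ _ ∷ M!) = M!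

disjoint-fst∉ : ∀ M → Disjoint ((p , q) ∷ M) → ¬ Covers M p
disjoint-fst∉ M (p∉ ∷ _) c = All.lookup p∉ (there c) refl

disjoint-snd∉ : ∀ M → Disjoint ((p , q) ∷ M) → ¬ Covers M q
disjoint-snd∉ M (_ ∷ q∉ ∷ _) c = All.lookup q∉ c refl

disjoint-fst≢snd : ∀ M → Disjoint ((p , q) ∷ M) → p ≢ q
disjoint-fst≢snd M (p∉ ∷ _) = All.lookup p∉ (here refl)

disjoint-∷⁺ : p ≢ q → ¬ Covers M p → ¬ Covers M q → Disjoint M → Disjoint ((p , q) ∷ M)
disjoint-∷⁺ p≢q p∉ q∉ M! =
  All.tabulate (λ { (here refl) → p≢q ; (there c) refl → p∉ c }) ∷
  All.tabulate (λ { c refl → q∉ c }) ∷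
  M!

matched-irrefl : Disjoint M → Matched M u v → u ≢ v
matched-irrefl {M = _ ∷ M} M! (inj₁ (here refl)) = disjoint-fst≢snd M M!
matched-irrefl {M = _ ∷ M} M! (inj₂ (here refl)) = disjoint-fst≢snd M M! ∘ sym
matched-irrefl {M = _ ∷ M} M! (inj₁ (there i))   = matched-irrefl (disjoint-tail M M!) (inj₁ i)
matched-irrefl {M = _ ∷ M} M! (inj₂ (there i))   = matched-irrefl (disjoint-tail M M!) (inj₂ i)

covers-─⁻ : (i : e ∈ₗ M) → Covers (M ─ i) t → Covers M t
covers-─⁻ {M = _ ∷ M} (here _)  c                   = there (there c)
covers-─⁻ {M = _ ∷ M} (there i) (here refl)         = here refl
covers-─⁻ {M = _ ∷ M} (there i) (there (here refl)) = there (here refl)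
covers-─⁻ {M = _ ∷ M} (there i) (there (there c))   = there (there (covers-─⁻ i c))

disjoint-─ : (i : e ∈ₗ M) → Disjoint M → Disjoint (M ─ i)
disjoint-─ {M = _ ∷ M} (here _)  M! = disjoint-tail M M!
disjoint-─ {M = _ ∷ M} (there i) M! =
  disjoint-∷⁺ {M = M ─ i} (disjoint-fst≢snd M M!)
    (disjoint-fst∉ M M! ∘ covers-─⁻ i) (disjoint-snd∉ M M! ∘ covers-─⁻ i) (disjoint-─ i (disjoint-tail M M!))

─-fst∉ : (i : (u , v) ∈ₗ M) → Disjoint M → ¬ Covers (M ─ i) u
─-fst∉ {M = _ ∷ M} (here refl) M! c                   = disjoint-fst∉ M M! c
─-fst∉ {M = _ ∷ M} (there i)   M! (here refl)         = disjoint-fst∉ M M! (∈⇒covers-fst i)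
─-fst∉ {M = _ ∷ M} (there i)   M! (there (here refl)) = disjoint-snd∉ M M! (∈⇒covers-fst i)
─-fst∉ {M = _ ∷ M} (there i)   M! (there (there c))   = ─-fst∉ i (disjoint-tail M M!) c

─-snd∉ : (i : (u , v) ∈ₗ M) → Disjoint M → ¬ Covers (M ─ i) v
─-snd∉ {M = _ ∷ M} (here refl) M! c                   = disjoint-snd∉ M M! c
─-snd∉ {M = _ ∷ M} (there i)   M! (here refl)         = disjoint-fst∉ M M! (∈⇒covers-snd i)
─-snd∉ {M = _ ∷ M} (there i)   M! (there (here refl)) = disjoint-snd∉ M M! (∈⇒covers-snd i)
─-snd∉ {M = _ ∷ M} (there i)   M! (there (there c))   = ─-snd∉ i (disjoint-tail M M!) c

record Removal (G : Graph n) (M : EdgeList n) (u v : Fin n) : Set where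
  field
    rest          : EdgeList n
    rest-matching : IsMatching G rest
    rest-length   : suc (length rest) ≡ length M
    u∉rest        : ¬ Covers rest u
    v∉rest        : ¬ Covers rest v
    matched-rest⁻ : ∀ {s t} → Matched rest s t → Matched M s t
    matched-rest⁺ : ∀ {s t} → Matched M s t → s ≢ u → s ≢ v → Matched rest s t

  covers-rest⁻ : ∀ {s} → Covers rest s → Covers M s
  covers-rest⁻ c = matched⇒covers (matched-rest⁻ (proj₂ (covers⇒matched rest c)))

remove∈ : IsMatching G M → (u , v) ∈ₗ M → Removal G M u v
remove∈ {M = M} (M-edges , M!) i = record
  { rest          = M ─ i
  ; rest-matching = ─⁺ i M-edges , disjoint-─ i M!
  ; rest-length   = sym (length-removeAt′ M (index i))
  ; u∉rest        = ─-fst∉ i M!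
  ; v∉rest        = ─-snd∉ i M!
  ; matched-rest⁻ = λ { (inj₁ j) → inj₁ (∈-─⁻ i j) ; (inj₂ j) → inj₂ (∈-─⁻ i j) }
  ; matched-rest⁺ = λ { (inj₁ j) s≢u _ → inj₁ (∈-─⁺ i j (s≢u ∘ cong proj₁))
                      ; (inj₂ j) _ s≢v → inj₂ (∈-─⁺ i j (s≢v ∘ cong proj₂)) }
  }

remove : IsMatching G M → Matched M u v → Removal G M u v
remove M-matching (inj₁ i) = remove∈ M-matching i
remove M-matching (inj₂ i) = record
  { Removal r
  ; u∉rest        = v∉rest
  ; v∉rest        = u∉rest
  ; matched-rest⁺ = λ m s≢u s≢v → matched-rest⁺ m s≢v s≢u
  }
  where
  r = remove∈ M-matching i
  open Removal r

∷-isMatching : IsMatching G M → u ≢ v → ¬ Covers M u → ¬ Covers M v → G u v ≡ true →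
  IsMatching G ((u , v) ∷ M)
∷-isMatching {M = M} (M-edges , M!) u≢v u∉M v∉M uv∈G =
  uv∈G ∷ M-edges , disjoint-∷⁺ {M = M} u≢v u∉M v∉M M!

loopless : IsGraph G → G u v ≡ true → u ≢ v
loopless (_ , G-loopless) uv∈G refl with trans (sym uv∈G) (G-loopless _)
... | ()

matched⇒edge : IsGraph G → IsMatching G M → Matched M u v → G u v ≡ true
matched⇒edge _                (M-edges , _) (inj₁ i) = All.lookup M-edges i
matched⇒edge (G-symmetric , _) (M-edges , _) (inj₂ i) = G-symmetric _ _ (All.lookup M-edges i)

partner : EdgeList n → Fin n → Fin n
partner []            v = v
partner ((p , q) ∷ M) v with v ≟ p | v ≟ q
... | yes _ | _     = q
... | no _  | yes _ = p
... | no _  | no _  = partner M v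

partner-matched : Disjoint M → Matched M u v → partner M u ≡ v
partner-matched {M = []} _ (inj₁ ())
partner-matched {M = []} _ (inj₂ ())
partner-matched {M = (p , q) ∷ M} {u} M! m with u ≟ p | u ≟ q | matched-∷⁻ m
... | yes _    | _        | inj₁ (_ , v≡q)         = sym v≡q
... | yes refl | _        | inj₂ (inj₁ (u≡q , _))  = ⊥-elim (disjoint-fst≢snd M M! u≡q)
... | yes refl | _        | inj₂ (inj₂ m′)         = ⊥-elim (disjoint-fst∉ M M! (matched⇒covers m′))
... | no u≢p   | _        | inj₁ (u≡p , _)         = ⊥-elim (u≢p u≡p)
... | no _     | yes _    | inj₂ (inj₁ (_ , v≡p))  = sym v≡p
... | no _     | yes refl | inj₂ (inj₂ m′)         = ⊥-elim (disjoint-snd∉ M M! (matched⇒covers m′))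
... | no _     | no u≢q   | inj₂ (inj₁ (u≡q , _))  = ⊥-elim (u≢q u≡q)
... | no _     | no _     | inj₂ (inj₂ m′)         = partner-matched (disjoint-tail M M!) m′

matched-partner : ∀ M → Disjoint M → Covers M u → Matched M u (partner M u)
matched-partner {u = u} M M! c with covers⇒matched M c
... | v , m = subst (Matched M u) (sym (partner-matched M! m)) m

partner-injectiveOn : ∀ M → Disjoint M → Covers M u → Covers M v → partner M u ≡ partner M v → u ≡ v
partner-injectiveOn {u = u} {v = v} M M! u∈M v∈M eq = begin
  u                             ≡⟨ sym (partner-involutive u∈M) ⟩
  partner M (partner M u)       ≡⟨ cong (partner M) eq ⟩
  partner M (partner M v)       ≡⟨ partner-involutive v∈M ⟩
  v                             ∎
  where
  open ≡-Reasoning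
  partner-involutive : ∀ {x} → Covers M x → partner M (partner M x) ≡ x
  partner-involutive c = partner-matched M! (matched-sym (matched-partner M M! c))

-- The matching number and inessential vertices

covers? : (M : EdgeList n) (v : Fin n) → Dec (Covers M v)
covers? M v = Any.any? (v ≟_) (endpoints M)

isMatching? : (G : Graph n) (M : EdgeList n) → Dec (IsMatching G M)
isMatching? G M =
  All.all? (λ { (u , v) → G u v Bool.≟ true }) M ×-dec allPairs? (λ x y → ¬? (x ≟ y)) (endpoints M)

∃-ofLength? : (P : EdgeList n → Set) → (∀ M → Dec (P M)) → ∀ k → Dec (∃[ M ] length M ≡ k × P M)
∃-ofLength? P P? zero with P? []
... | yes p = yes ([] , refl , p)
... | no ¬p = no λ { ([] , refl , p) → ¬p p }
∃-ofLength? P P? (suc k)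
  with Fin.any? (λ u → Fin.any? λ v → ∃-ofLength? (P ∘ ((u , v) ∷_)) (P? ∘ ((u , v) ∷_)) k)
... | yes (u , v , M , refl , p) = yes ((u , v) ∷ M , refl , p)
... | no ∄ = no λ { ((u , v) ∷ M , refl , p) → ∄ (u , v , M , refl , p) }

length≤length-endpoints : (M : EdgeList n) → length M ≤ length (endpoints M)
length≤length-endpoints []      = z≤n
length≤length-endpoints (_ ∷ M) = s≤s (m≤n⇒m≤1+n (length≤length-endpoints M))

matching-length≤n : ∀ {n} {G : Graph n} {M} → IsMatching G M → length M ≤ n
matching-length≤n {M = M} (_ , M!) = ≤-trans (length≤length-endpoints M) (Unique⇒length≤n M!)

largestMatchingUpTo : (G : Graph n) → ∀ k → (∀ M → IsMatching G M → length M ≤ k) → ∃ (MatchingNumber G)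
largestMatchingUpTo G zero    ≤0 = 0 , ([] , ([] , []) , refl) , ≤0
largestMatchingUpTo G (suc k) ≤1+k with ∃-ofLength? (IsMatching G) (isMatching? G) (suc k)
... | yes (M , |M|≡1+k , M-matching) = suc k , (M , M-matching , |M|≡1+k) , ≤1+k
... | no ∄ = largestMatchingUpTo G k λ M M-matching →
  ≤-pred (≤∧≢⇒< (≤1+k M M-matching) (λ |M|≡1+k → ∄ (M , |M|≡1+k , M-matching)))

matchingNumber : (G : Graph n) → ∃ (MatchingNumber G)
matchingNumber {n} G = largestMatchingUpTo G n (λ _ → matching-length≤n)

MatchingNumber-unique : ∀ {k k′} → MatchingNumber G k → MatchingNumber G k′ → k ≡ k′
MatchingNumber-unique ((M , M-matching , refl) , ≤k) ((M′ , M′-matching , refl) , ≤k′) =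
  ≤-antisym (≤k′ M M-matching) (≤k M′ M′-matching)

Exposable : Graph n → ℕ → Fin n → Set
Exposable G ν v = ∃[ M ] length M ≡ ν × IsMatching G M × ¬ Covers M v

exposable? : (G : Graph n) (ν : ℕ) (v : Fin n) → Dec (Exposable G ν v)
exposable? G ν v = ∃-ofLength? _ (λ M → isMatching? G M ×-dec ¬? (covers? M v)) ν

module _ {G : Graph n} {ν : ℕ} (ν-number : MatchingNumber G ν) where

  size⇒maximum : IsMatching G M → length M ≡ ν → IsMaximumMatching G M
  size⇒maximum M-matching |M|≡ν =
    M-matching , λ M′ M′-matching → subst (_ ≤_) (sym |M|≡ν) (proj₂ ν-number M′ M′-matching)

  maximum⇒size : IsMaximumMatching G M → length M ≡ ν
  maximum⇒size {M} (M-matching , M-max) with proj₁ ν-number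
  ... | M₀ , M₀-matching , refl = ≤-antisym (proj₂ ν-number M M-matching) (M-max M₀ M₀-matching)

  exposable⇒InD : Exposable G ν v → InD G v
  exposable⇒InD (M , |M|≡ν , M-matching , v∉M) v-essential =
    v∉M (v-essential M (size⇒maximum M-matching |M|≡ν))

  InD⇒exposable : InD G v → Exposable G ν v
  InD⇒exposable {v} v∈D with exposable? G ν v
  ... | yes v-exposable = v-exposable
  ... | no ¬v-exposable = ⊥-elim (v∈D v-essential)
    where
    v-essential : Essential G v
    v-essential M M-maximum with covers? M v
    ... | yes v∈M = v∈M
    ... | no v∉M  = ⊥-elim (¬v-exposable (M , maximum⇒size M-maximum , proj₁ M-maximum , v∉M))

maximum⇒matchingNumber : IsMaximumMatching G M → MatchingNumber G (length M)
maximum⇒matchingNumber {M = M} (M-matching , M-max) = (M , M-matching , refl) , M-max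

maximum-covers-¬InD : IsMaximumMatching G M → ¬ InD G v → Covers M v
maximum-covers-¬InD {M = M} {v = v} M-maximum v∉D with covers? M v
... | yes v∈M = v∈M
... | no v∉M  =
  ⊥-elim (v∉D (exposable⇒InD (maximum⇒matchingNumber M-maximum) (M , refl , proj₁ M-maximum , v∉M)))

maximumMatching : (G : Graph n) → ∃ (IsMaximumMatching G)
maximumMatching G with matchingNumber G
... | _ , (M , M-matching , refl) , M-max = M , M-matching , M-max

InD? : (G : Graph n) → Decidable (InD G)
InD? G v with matchingNumber G
... | ν , ν-number = map′ (exposable⇒InD ν-number) (InD⇒exposable ν-number) (exposable? G ν v)

InA? : (G : Graph n) → Decidable (InA G)
InA? G v = ¬? (InD? G v) ×-dec Fin.any? (λ w → InD? G w ×-dec (G v w Bool.≟ true))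

-- Adding an edge

addEdge⁻ : ∀ (G : Graph n) u v x y → addEdge G u v x y ≡ true →
  G x y ≡ true ⊎ (x ≡ u × y ≡ v) ⊎ (x ≡ v × y ≡ u)
addEdge⁻ G u v x y e with G x y | x ≟ u | y ≟ v | x ≟ v | y ≟ u
addEdge⁻ G u v x y _  | true  | _       | _       | _       | _       = inj₁ refl
addEdge⁻ G u v x y _  | false | yes x≡u | yes y≡v | _       | _       = inj₂ (inj₁ (x≡u , y≡v))
addEdge⁻ G u v x y _  | false | _       | _       | yes x≡v | yes y≡u = inj₂ (inj₂ (x≡v , y≡u))
addEdge⁻ G u v x y () | false | no _    | _       | no _    | _
addEdge⁻ G u v x y () | false | no _    | _       | yes _   | no _
addEdge⁻ G u v x y () | false | yes _   | no _    | no _    | _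
addEdge⁻ G u v x y () | false | yes _   | no _    | yes _   | no _

⊆-addEdge : ∀ (G : Graph n) u v → G ⊆ᴳ addEdge G u v
⊆-addEdge G u v x y xy∈G rewrite xy∈G = refl

addEdge-∋ : ∀ (G : Graph n) u v → addEdge G u v u v ≡ true
addEdge-∋ G u v with u ≟ u | v ≟ v
... | yes _   | yes _   = ∨-zeroʳ (G u v)
... | no u≢u  | _       = ⊥-elim (u≢u refl)
... | _       | no v≢v  = ⊥-elim (v≢v refl)

addEdge-∋′ : ∀ (G : Graph n) u v → addEdge G u v v u ≡ true
addEdge-∋′ G u v with v ≟ v | u ≟ u
... | yes _   | yes _   = trans (cong (G v u ∨_) (∨-zeroʳ _)) (∨-zeroʳ (G v u))
... | no v≢v  | _       = ⊥-elim (v≢v refl)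
... | _       | no u≢u  = ⊥-elim (u≢u refl)

addEdge-isGraph : IsGraph G → u ≢ v → IsGraph (addEdge G u v)
addEdge-isGraph {G = G} {u} {v} G-graph@(G-symmetric , _) u≢v = symmetric , irreflexive
  where
  symmetric : ∀ x y → addEdge G u v x y ≡ true → addEdge G u v y x ≡ true
  symmetric x y xy∈ with addEdge⁻ G u v x y xy∈
  ... | inj₁ xy∈G               = ⊆-addEdge G u v y x (G-symmetric x y xy∈G)
  ... | inj₂ (inj₁ (refl , refl)) = addEdge-∋′ G u v
  ... | inj₂ (inj₂ (refl , refl)) = addEdge-∋ G u v
  irreflexive : ∀ x → addEdge G u v x x ≡ false
  irreflexive x with addEdge G u v x x in xx∈
  ... | false = refl
  ... | true with addEdge⁻ G u v x x xx∈
  ...   | inj₁ xx∈G               = ⊥-elim (loopless G-graph xx∈G refl)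
  ...   | inj₂ (inj₁ (refl , refl)) = ⊥-elim (u≢v refl)
  ...   | inj₂ (inj₂ (refl , refl)) = ⊥-elim (u≢v refl)

addEdge-⊆ : ∀ {H : Graph n} → IsGraph H → G ⊆ᴳ H → H u v ≡ true → addEdge G u v ⊆ᴳ H
addEdge-⊆ {G = G} {u} {v} (H-symmetric , _) G⊆H uv∈H x y xy∈ with addEdge⁻ G u v x y xy∈
... | inj₁ xy∈G               = G⊆H x y xy∈G
... | inj₂ (inj₁ (refl , refl)) = uv∈H
... | inj₂ (inj₂ (refl , refl)) = H-symmetric _ _ uv∈H

isMatching-mono : ∀ {G′ : Graph n} → G ⊆ᴳ G′ → IsMatching G M → IsMatching G′ M
isMatching-mono G⊆G′ (M-edges , M!) = All.map (λ {e} → G⊆G′ (proj₁ e) (proj₂ e)) M-edges , M!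

addEdge-isMatching⁻ : IsMatching (addEdge G u v) M → ¬ Covers M u → IsMatching G M
addEdge-isMatching⁻ {G = G} {u} {v} {M} (M-edges , M!) u∉M = All.tabulate edge∈G , M!
  where
  edge∈G : ∀ {e} → e ∈ₗ M → G (proj₁ e) (proj₂ e) ≡ true
  edge∈G {e} i with addEdge⁻ G u v (proj₁ e) (proj₂ e) (All.lookup M-edges i)
  ... | inj₁ e∈G               = e∈G
  ... | inj₂ (inj₁ (refl , _)) = ⊥-elim (u∉M (∈⇒covers-fst i))
  ... | inj₂ (inj₂ (_ , refl)) = ⊥-elim (u∉M (∈⇒covers-snd i))

addEdge-preserves-ν : ∀ {k} → ¬ InD G u → MatchingNumber G k → MatchingNumber (addEdge G u v) k
addEdge-preserves-ν {G = G} {u} {v} {k} u∉D ν-number@((M₀ , M₀-matching , |M₀|≡k) , ≤k) =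
  (M₀ , isMatching-mono (⊆-addEdge G u v) M₀-matching , |M₀|≡k) , ≤k′
  where
  ≤k′ : ∀ M → IsMatching (addEdge G u v) M → length M ≤ k
  ≤k′ M M-matching with covers? M u
  ... | no u∉M  = ≤k M (addEdge-isMatching⁻ M-matching u∉M)
  ... | yes u∈M = ≤k-without-u (remove M-matching (proj₂ (covers⇒matched M u∈M)))
    where
    ≤k-without-u : ∀ {w} → Removal (addEdge G u v) M u w → length M ≤ k
    ≤k-without-u r = subst (_≤ k) rest-length (≤∧≢⇒< (≤k rest rest-in-G) u-not-exposed)
      where
      open Removal r
      rest-in-G = addEdge-isMatching⁻ rest-matching u∉rest
      u-not-exposed : length rest ≢ k
      u-not-exposed |rest|≡k = u∉D (exposable⇒InD ν-number (rest , |rest|≡k , rest-in-G , u∉rest))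

-- Partners of A-vertices lie in D

module AlternatingWalk {n : ℕ} {G : Graph n} (G-graph : IsGraph G) {ν : ℕ}
  (ν-max : ∀ M → IsMatching G M → length M ≤ ν) {a b d : Fin n} (ad∈G : G a d ≡ true) where

  Outcome : Set
  Outcome = Exposable G ν b ⊎ Exposable G ν a

  a≢d : a ≢ d
  a≢d = loopless G-graph ad∈G

  no-augmenting-edge : ∀ {R x y} → IsMatching G R → length R ≡ ν →
    ¬ Covers R x → ¬ Covers R y → G x y ≡ true → ⊥
  no-augmenting-edge R-matching refl x∉R y∉R xy∈G =
    1+n≰n (ν-max _ (∷-isMatching R-matching (loopless G-graph xy∈G) x∉R y∉R xy∈G))

  -- The walk follows an alternating path d, a, y, z, … : it starts with R a
  -- maximum matching exposing d and L = M − ab; each step takes y, the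
  -- R-partner of x, and z, the L-partner of y, and R trades xy for wx while
  -- L trades yz for xy. It stops when y = b, when y is exposed in L (then
  -- L + xy exposes b) or when z = d (then R − da + yd exposes a). The
  -- closure invariants keep y and z outside the visited vertices, so the
  -- walk stops within n steps.
  record State : Set where
    field
      visited        : List (Fin n)
      L R            : EdgeList n
      w x            : Fin n
      L-matching     : IsMatching G L
      L-size         : suc (length L) ≡ ν
      R-matching     : IsMatching G R
      R-size         : length R ≡ ν
      w∉R            : ¬ Covers R w
      x∉L            : ¬ Covers L x
      b∉L            : ¬ Covers L b
      wx∈G           : G w x ≡ true
      b∉visited      : b ∉ₗ visited
      x∈visited      : x ∈ₗ visited
      w∈visited      : w ∈ₗ visited
      a∈visited      : a ∈ₗ visited
      d∈visited      : d ∈ₗ visited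
      x≢d            : x ≢ d
      R-closed       : ∀ {v q} → v ∈ₗ visited → v ≢ x → Matched R v q → q ∈ₗ visited × q ≢ x
      L-closed       : ∀ {v q} → v ∈ₗ visited → v ≢ d → Matched L v q → q ∈ₗ visited
      da-link        : (w ≡ d × x ≡ a) ⊎ (Matched R d a × w ≢ d)
      visited-unique : Unique visited

  Next : State → Set
  Next s = Σ State λ s′ → length (State.visited s) < length (State.visited s′)

  module Step (s : State) {y : Fin n} (xy∈R : Matched (State.R s) (State.x s) y) where
    open State s

    module R∖xy = Removal (remove R-matching xy∈R)

    R′ : EdgeList n
    R′ = (w , x) ∷ R∖xy.rest

    R′-matching : IsMatching G R′
    R′-matching =
      ∷-isMatching R∖xy.rest-matching (loopless G-graph wx∈G) (w∉R ∘ R∖xy.covers-rest⁻) R∖xy.u∉rest wx∈G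

    R′-size : length R′ ≡ ν
    R′-size = trans R∖xy.rest-length R-size

    y≢x : y ≢ x
    y≢x = matched-irrefl (proj₂ R-matching) xy∈R ∘ sym

    y∉R′ : ¬ Covers R′ y
    y∉R′ c with covers-∷⁻ R∖xy.rest c
    ... | inj₁ refl          = w∉R (matched⇒covers (matched-sym xy∈R))
    ... | inj₂ (inj₁ y≡x)    = y≢x y≡x
    ... | inj₂ (inj₂ y∈rest) = R∖xy.v∉rest y∈rest

    y∉visited : y ∉ₗ visited
    y∉visited y∈V = proj₂ (R-closed y∈V y≢x (matched-sym xy∈R)) refl

    y≢d : y ≢ d
    y≢d refl = y∉visited d∈visited

    da∈R′ : Matched R′ d a
    da∈R′ with da-link
    ... | inj₁ (refl , refl) = inj₁ (here refl)
    ... | inj₂ (da∈R , _)    = matched-there (R∖xy.matched-rest⁺ da∈R (x≢d ∘ sym) (y≢d ∘ sym))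

    R′-exposes-b : y ≡ b → Exposable G ν b
    R′-exposes-b refl = R′ , R′-size , R′-matching , y∉R′

    L+xy-exposes-b : y ≢ b → ¬ Covers L y → Exposable G ν b
    L+xy-exposes-b y≢b y∉L =
      (x , y) ∷ L , L-size ,
      ∷-isMatching L-matching (y≢x ∘ sym) x∉L y∉L (matched⇒edge G-graph R-matching xy∈R) , b∉
      where
      b∉ : ¬ Covers ((x , y) ∷ L) b
      b∉ c with covers-∷⁻ L c
      ... | inj₁ refl       = b∉visited x∈visited
      ... | inj₂ (inj₁ b≡y) = y≢b (sym b≡y)
      ... | inj₂ (inj₂ b∈L) = b∉L b∈L

    R′-da+yd-exposes-a : Matched L y d → Exposable G ν a
    R′-da+yd-exposes-a yd∈L =
      (y , d) ∷ R′∖da.rest , trans R′∖da.rest-length R′-size ,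
      ∷-isMatching R′∖da.rest-matching y≢d (y∉R′ ∘ R′∖da.covers-rest⁻) R′∖da.u∉rest
        (matched⇒edge G-graph L-matching yd∈L) ,
      a∉
      where
      module R′∖da = Removal (remove R′-matching da∈R′)
      a∉ : ¬ Covers ((y , d) ∷ R′∖da.rest) a
      a∉ c with covers-∷⁻ R′∖da.rest c
      ... | inj₁ refl          = y∉visited a∈visited
      ... | inj₂ (inj₁ a≡d)    = a≢d a≡d
      ... | inj₂ (inj₂ a∈rest) = R′∖da.v∉rest a∈rest

    module Advance (y≢b : y ≢ b) {z : Fin n} (yz∈L : Matched L y z) (z≢d : z ≢ d) where

      module L∖yz = Removal (remove L-matching yz∈L)

      L′ : EdgeList n
      L′ = (x , y) ∷ L∖yz.rest

      visited′ : List (Fin n)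
      visited′ = y ∷ z ∷ visited

      z∉visited : z ∉ₗ visited
      z∉visited z∈V = y∉visited (L-closed z∈V z≢d (matched-sym yz∈L))

      y≢z : y ≢ z
      y≢z = matched-irrefl (proj₂ L-matching) yz∈L

      fresh : ∀ {v} → v ∈ₗ visited → v ≢ z
      fresh v∈V refl = z∉visited v∈V

      z∉L′ : ¬ Covers L′ z
      z∉L′ c with covers-∷⁻ L∖yz.rest c
      ... | inj₁ refl          = x∉L (matched⇒covers (matched-sym yz∈L))
      ... | inj₂ (inj₁ z≡y)    = y≢z (sym z≡y)
      ... | inj₂ (inj₂ z∈rest) = L∖yz.v∉rest z∈rest

      b∉L′ : ¬ Covers L′ b
      b∉L′ c with covers-∷⁻ L∖yz.rest c
      ... | inj₁ refl          = b∉visited x∈visited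
      ... | inj₂ (inj₁ b≡y)    = y≢b (sym b≡y)
      ... | inj₂ (inj₂ b∈rest) = b∉L (L∖yz.covers-rest⁻ b∈rest)

      b∉visited′ : b ∉ₗ visited′
      b∉visited′ (here b≡y)          = y≢b (sym b≡y)
      b∉visited′ (there (here refl)) = b∉L (matched⇒covers (matched-sym yz∈L))
      b∉visited′ (there (there b∈V)) = b∉visited b∈V

      visited′⁻ : ∀ {v} → v ∈ₗ visited′ → v ≢ y → v ≢ z → v ∈ₗ visited
      visited′⁻ (here v≡y)          v≢y _   = ⊥-elim (v≢y v≡y)
      visited′⁻ (there (here v≡z))  _   v≢z = ⊥-elim (v≢z v≡z)
      visited′⁻ (there (there v∈V)) _   _   = v∈V

      R′-closed : ∀ {v q} → v ∈ₗ visited′ → v ≢ z → Matched R′ v q → q ∈ₗ visited′ × q ≢ z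
      R′-closed v∈V′ v≢z vq∈R′ with matched-∷⁻ vq∈R′
      ... | inj₁ (refl , refl)        = there (there x∈visited) , fresh x∈visited
      ... | inj₂ (inj₁ (refl , refl)) = there (there w∈visited) , fresh w∈visited
      ... | inj₂ (inj₂ vq∈rest)       = there (there q∈V) , fresh q∈V
        where
        v∈rest = matched⇒covers vq∈rest
        v∈V = visited′⁻ v∈V′ (λ { refl → R∖xy.v∉rest v∈rest }) v≢z
        q∈V = proj₁ (R-closed v∈V (λ { refl → R∖xy.u∉rest v∈rest }) (R∖xy.matched-rest⁻ vq∈rest))

      L′-closed : ∀ {v q} → v ∈ₗ visited′ → v ≢ d → Matched L′ v q → q ∈ₗ visited′
      L′-closed v∈V′ v≢d vq∈L′ with matched-∷⁻ vq∈L′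
      ... | inj₁ (refl , refl)        = here refl
      ... | inj₂ (inj₁ (refl , refl)) = there (there x∈visited)
      ... | inj₂ (inj₂ vq∈rest)       = there (there (L-closed v∈V v≢d (L∖yz.matched-rest⁻ vq∈rest)))
        where
        v∈rest = matched⇒covers vq∈rest
        v∈V = visited′⁻ v∈V′ (λ { refl → L∖yz.u∉rest v∈rest }) (λ { refl → L∖yz.v∉rest v∈rest })

      next : Next s
      next = record
        { visited        = visited′
        ; L              = L′
        ; R              = R′
        ; w              = y
        ; x              = z
        ; L-matching     = ∷-isMatching L∖yz.rest-matching (y≢x ∘ sym) (x∉L ∘ L∖yz.covers-rest⁻) L∖yz.u∉rest
                             (matched⇒edge G-graph R-matching xy∈R)
        ; L-size         = trans (cong suc L∖yz.rest-length) L-size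
        ; R-matching     = R′-matching
        ; R-size         = R′-size
        ; w∉R            = y∉R′
        ; x∉L            = z∉L′
        ; b∉L            = b∉L′
        ; wx∈G           = matched⇒edge G-graph L-matching yz∈L
        ; b∉visited      = b∉visited′
        ; x∈visited      = there (here refl)
        ; w∈visited      = here refl
        ; a∈visited      = there (there a∈visited)
        ; d∈visited      = there (there d∈visited)
        ; x≢d            = z≢d
        ; R-closed       = R′-closed
        ; L-closed       = L′-closed
        ; da-link        = inj₂ (da∈R′ , y≢d)
        ; visited-unique = (y≢z ∷ ¬Any⇒All¬ visited y∉visited) ∷ ¬Any⇒All¬ visited z∉visited ∷ visited-unique
        } , s≤s (n≤1+n _)

    result : Outcome ⊎ Next s
    result with y ≟ b
    ... | yes y≡b = inj₁ (inj₁ (R′-exposes-b y≡b))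
    ... | no y≢b with covers? L y
    ...   | no y∉L  = inj₁ (inj₁ (L+xy-exposes-b y≢b y∉L))
    ...   | yes y∈L with covers⇒matched L y∈L
    ...     | z , yz∈L with z ≟ d
    ...       | yes refl = inj₁ (inj₂ (R′-da+yd-exposes-a yz∈L))
    ...       | no z≢d   = inj₂ (Advance.next y≢b yz∈L z≢d)

  walk-step : (s : State) → Outcome ⊎ Next s
  walk-step s with covers? (State.R s) (State.x s)
  ... | yes x∈R = Step.result s (proj₂ (covers⇒matched (State.R s) x∈R))
  ... | no x∉R  = ⊥-elim (no-augmenting-edge R-matching R-size w∉R x∉R wx∈G)
    where open State s

  walk : (fuel : ℕ) (s : State) → n < fuel + length (State.visited s) → Outcome
  walk zero        s n<|V| = ⊥-elim (<⇒≱ n<|V| (Unique⇒length≤n (State.visited-unique s)))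
  walk (suc fuel) s n<1+fuel+|V| with walk-step s
  ... | inj₁ outcome      = outcome
  ... | inj₂ (s′ , |V|<|V′|) = walk fuel s′
    (<-≤-trans n<1+fuel+|V| (≤-trans (≤-reflexive (sym (+-suc fuel _))) (+-monoʳ-≤ fuel |V|<|V′|)))

  exchange : ∀ {M} → IsMatching G M → length M ≡ ν → Matched M a b → Exposable G ν d → Outcome
  exchange M-matching |M|≡ν ab∈M (N , |N|≡ν , N-matching , d∉N) with b ≟ d
  ... | yes refl = inj₁ (N , |N|≡ν , N-matching , d∉N)
  ... | no b≢d   = walk n initial (m<m+n n (s≤s z≤n))
    where
    module M∖ab = Removal (remove M-matching ab∈M)

    b∉da : b ∉ₗ d ∷ a ∷ []
    b∉da (here b≡d)         = b≢d b≡d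
    b∉da (there (here b≡a)) = matched-irrefl (proj₂ M-matching) ab∈M (sym b≡a)

    initial : State
    initial = record
      { visited        = d ∷ a ∷ []
      ; L              = M∖ab.rest
      ; R              = N
      ; w              = d
      ; x              = a
      ; L-matching     = M∖ab.rest-matching
      ; L-size         = trans M∖ab.rest-length |M|≡ν
      ; R-matching     = N-matching
      ; R-size         = |N|≡ν
      ; w∉R            = d∉N
      ; x∉L            = M∖ab.u∉rest
      ; b∉L            = M∖ab.v∉rest
      ; wx∈G           = proj₁ G-graph a d ad∈G
      ; b∉visited      = b∉da
      ; x∈visited      = there (here refl)
      ; w∈visited      = here refl
      ; a∈visited      = there (here refl)
      ; d∈visited      = here refl
      ; x≢d            = a≢d
      ; R-closed       = λ { (here refl) _ dq∈N → ⊥-elim (d∉N (matched⇒covers dq∈N))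
                           ; (there (here refl)) v≢a _ → ⊥-elim (v≢a refl) }
      ; L-closed       = λ { (here refl) v≢d _ → ⊥-elim (v≢d refl)
                           ; (there (here refl)) _ aq∈L → ⊥-elim (M∖ab.u∉rest (matched⇒covers aq∈L)) }
      ; da-link        = inj₁ (refl , refl)
      ; visited-unique = ((a≢d ∘ sym) ∷ []) ∷ [] ∷ []
      }

InA-partner-InD : IsGraph G → IsMaximumMatching G M → Matched M u v → InA G u → InD G v
InA-partner-InD G-graph M-maximum@(M-matching , M-max) uv∈M (u∉D , d , d∈D , ud∈G) =
  [ exposable⇒InD ν-number , ⊥-elim ∘ u∉D ∘ exposable⇒InD ν-number ]′
    (AlternatingWalk.exchange G-graph M-max ud∈G M-matching refl uv∈M (InD⇒exposable ν-number d∈D))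
  where
  ν-number = maximum⇒matchingNumber M-maximum

-- The bound |A| ≤ |D| and the partition of the vertices

Dˢ : Graph n → Subset n
Dˢ G = subsetOf (InD? G)

Aˢ : Graph n → Subset n
Aˢ G = subsetOf (InA? G)

∣A∣≤∣D∣ : IsGraph G → IsMaximumMatching G M → ∣ Aˢ G ∣ ≤ ∣ Dˢ G ∣
∣A∣≤∣D∣ {G = G} {M = M} G-graph M-maximum@(M-matching , _) =
  injectiveOn⇒∣p∣≤∣q∣ (Aˢ G) (Dˢ G) (partner M) into injective
  where
  A⊆M : ∀ {u} → u ∈ Aˢ G → Covers M u
  A⊆M u∈A = maximum-covers-¬InD M-maximum (proj₁ (∈-subsetOf⁻ (InA? G) u∈A))

  into : ∀ {u} → u ∈ Aˢ G → partner M u ∈ Dˢ G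
  into u∈A = ∈-subsetOf⁺ (InD? G)
    (InA-partner-InD G-graph M-maximum (matched-partner M (proj₂ M-matching) (A⊆M u∈A))
      (∈-subsetOf⁻ (InA? G) u∈A))

  injective : ∀ {u v} → u ∈ Aˢ G → v ∈ Aˢ G → partner M u ≡ partner M v → u ≡ v
  injective u∈A v∈A = partner-injectiveOn M (proj₂ M-matching) (A⊆M u∈A) (A⊆M v∈A)

n≤∣C∣+∣A∣+∣D∣ : (C : Subset n) → (∀ v → InC G v → v ∈ C) → n ≤ ∣ C ∣ + (∣ Aˢ G ∣ + ∣ Dˢ G ∣)
n≤∣C∣+∣A∣+∣D∣ {G = G} C C⊇ = cover⇒n≤∣p∣+∣q∣+∣r∣ C (Aˢ G) (Dˢ G) classify
  where
  classify : ∀ v → v ∈ C ⊎ v ∈ Aˢ G ⊎ v ∈ Dˢ G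
  classify v with InD? G v | InA? G v
  ... | yes v∈D | _       = inj₂ (inj₂ (∈-subsetOf⁺ (InD? G) v∈D))
  ... | no _    | yes v∈A = inj₂ (inj₁ (∈-subsetOf⁺ (InA? G) v∈A))
  ... | no v∉D  | no v∉A  = inj₁ (C⊇ v (v∉D , v∉A))

-- Connectors and the size of C

NoCDEdge : Graph n → Graph n → Set
NoCDEdge {n} H G = ¬ (Σ (Fin n) λ u → Σ (Fin n) λ v → H u v ≡ true × InC G u × InD G v)

C∩D-empty : (C : Subset n) → (∀ {v} → v ∈ C → InC G v) → Empty (C ∩ Dˢ G)
C∩D-empty {G = G} C C⊆ (v , v∈C∩D) with x∈p∩q⁻ C (Dˢ G) v∈C∩D
... | v∈C , v∈D = proj₁ (C⊆ v∈C) (∈-subsetOf⁻ (InD? G) v∈D)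

∣D∣<s : ∀ {s} {H : Graph n} → IsConnector s H → NoCDEdge H G →
  (C : Subset n) → (∀ {v} → v ∈ C → InC G v) → s ≤ ∣ C ∣ → ∣ Dˢ G ∣ < s
∣D∣<s {G = G} {s} H-connector no-CD C C⊆ s≤∣C∣ with s ≤? ∣ Dˢ G ∣
... | no s≰∣D∣  = ≰⇒> s≰∣D∣
... | yes s≤∣D∣ with H-connector C (Dˢ G) (C∩D-empty C C⊆) s≤∣C∣ s≤∣D∣
...   | u , v , u∈C , v∈D , uv∈H = ⊥-elim (no-CD (u , v , uv∈H , C⊆ u∈C , ∈-subsetOf⁻ (InD? G) v∈D))

C-size-dichotomy : ∀ {s} {H : Graph n} → IsConnector s H → NoCDEdge H G → IsGraph G →
  (C : Subset n) → (∀ v → (v ∈ C → InC G v) × (InC G v → v ∈ C)) → ∣ C ∣ < s ⊎ n < ∣ C ∣ + 2 * s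
C-size-dichotomy {n} {G} {s} H-connector no-CD G-graph C C-exact with s ≤? ∣ C ∣
... | no s≰∣C∣  = inj₁ (≰⇒> s≰∣C∣)
... | yes s≤∣C∣ = inj₂ (begin-strict
  n                                 ≤⟨ n≤∣C∣+∣A∣+∣D∣ C (λ v → proj₂ (C-exact v)) ⟩
  ∣ C ∣ + (∣ Aˢ G ∣ + ∣ Dˢ G ∣)     <⟨ +-monoʳ-< ∣ C ∣ (+-mono-< (≤-<-trans ∣A∣≤∣D∣′ ∣D∣<s′) ∣D∣<s′) ⟩
  ∣ C ∣ + (s + s)                   ≡⟨ cong (λ t → ∣ C ∣ + (s + t)) (sym (+-identityʳ s)) ⟩
  ∣ C ∣ + 2 * s                     ∎)
  where
  open ≤-Reasoning
  ∣A∣≤∣D∣′ = ∣A∣≤∣D∣ G-graph (proj₂ (maximumMatching G))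
  ∣D∣<s′ = ∣D∣<s H-connector no-CD C (λ {v} → proj₁ (C-exact v)) s≤∣C∣

-- CD-saturation

saturation-⊇ : ∀ {H G G′ : Graph n} → CDSat H G G′ → G ⊆ᴳ G′
saturation-⊇ (stop _)                      _ _ xy∈G = xy∈G
saturation-⊇ {G = G} (step u v _ _ _ sat) x y xy∈G = saturation-⊇ sat x y (⊆-addEdge G u v x y xy∈G)

saturation-⊆ : ∀ {H G G′ : Graph n} → IsGraph H → G ⊆ᴳ H → CDSat H G G′ → G′ ⊆ᴳ H
saturation-⊆ H-graph G⊆H (stop _)                   = G⊆H
saturation-⊆ H-graph G⊆H (step _ _ uv∈H _ _ sat) = saturation-⊆ H-graph (addEdge-⊆ H-graph G⊆H uv∈H) sat

saturation-isGraph : ∀ {H G G′ : Graph n} → IsGraph G → CDSat H G G′ → IsGraph G′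
saturation-isGraph G-graph (stop _)                  = G-graph
saturation-isGraph G-graph (step _ _ _ u∈C v∈D sat) =
  saturation-isGraph (addEdge-isGraph G-graph (λ { refl → proj₁ u∈C v∈D })) sat

saturation-noCDEdge : ∀ {H G G′ : Graph n} → CDSat H G G′ → NoCDEdge H G′
saturation-noCDEdge (stop no-CD)           = no-CD
saturation-noCDEdge (step _ _ _ _ _ sat) = saturation-noCDEdge sat

saturation-ν : ∀ {H G G′ : Graph n} {k} → CDSat H G G′ → MatchingNumber G k → MatchingNumber G′ k
saturation-ν (stop _)                ν-number = ν-number
saturation-ν (step _ _ _ u∈C _ sat) ν-number = saturation-ν sat (addEdge-preserves-ν (proj₁ u∈C) ν-number)

saturation-ν⁻ : ∀ {H G G′ : Graph n} {k} → CDSat H G G′ → MatchingNumber G′ k → MatchingNumber G k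
saturation-ν⁻ {G = G} sat ν′-number with matchingNumber G
... | _ , ν-number =
  subst (MatchingNumber G) (MatchingNumber-unique (saturation-ν sat ν-number) ν′-number) ν-number

lemma2p4 : (n s : ℕ) (H G G' : Graph n) →
    IsGraph H → IsGraph G → G ⊆ᴳ H → IsConnector s H → CDSat H G G' →
    (G ⊆ᴳ G') × (G' ⊆ᴳ H) ×
    ((C' : Subset n) → (∀ v → (v ∈ C' → InC G' v) × (InC G' v → v ∈ C')) →
      (∣ C' ∣ < s) ⊎ (n < ∣ C' ∣ + 2 * s)) ×
    (∀ k → (MatchingNumber G k → MatchingNumber G' k) × (MatchingNumber G' k → MatchingNumber G k))
lemma2p4 n s H G G′ H-graph G-graph G⊆H H-connector sat =
  saturation-⊇ sat ,
  saturation-⊆ H-graph G⊆H sat ,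
  C-size-dichotomy H-connector (saturation-noCDEdge sat) (saturation-isGraph G-graph sat) ,
  λ k → saturation-ν sat , saturation-ν⁻ sat
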